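{- Let $f(x),g(x)\in\mathbb{Z}[x]$ be monic polynomials and $p$ a prime such that $g(x)$ is irreducible modulo $p$. Suppose $f(x)\in\langle p,g(x)^2\rangle$. Then $$f(x)\in\langle p,g(x)\rangle^2\iff f(x^p)\in\langle p,g(x)\rangle^2.$$
   Context: For $S\subset\mathbb{Z}[x]$, $\langle S\rangle$ denotes the ideal of $\mathbb{Z}[x]$ generated by $S$. -}

module Defs where

open import Data.Nat as ℕ using (ℕ; zero; suc; _<_)
open import Data.Integer as ℤ using (ℤ; +_; 0ℤ; 1ℤ)
open import Data.Integer.Divisibility using () renaming (_∣_ to _∣ℤ_)
open import Data.List using (List; []; _∷_; map; foldr)
open import Data.Product using (Σ; ∃; _×_; _,_; proj₁; proj₂)
open import Data.Sum using (_⊎_)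
open import Data.List.Relation.Unary.All using (All)
open import Relation.Binary.PropositionalEquality using (_≡_)
open import Relation.Nullary using (¬_)

-- Polynomials in ℤ[x] as coefficient lists, lowest degree first.
-- Trailing zeros are allowed; equality is coefficientwise (_≈P_).
Poly : Set
Poly = List ℤ

coeff : Poly → ℕ → ℤ
coeff []       _       = 0ℤ
coeff (a ∷ _)  zero    = a
coeff (_ ∷ as) (suc n) = coeff as n

infix 4 _≈P_
_≈P_ : Poly → Poly → Set
f ≈P g = ∀ n → coeff f n ≡ coeff g n

infixl 6 _+P_
_+P_ : Poly → Poly → Poly
[]       +P q        = q
(a ∷ as) +P []       = a ∷ as
(a ∷ as) +P (b ∷ bs) = (a ℤ.+ b) ∷ (as +P bs)

infixl 7 _*P_
_*P_ : Poly → Poly → Poly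
[]       *P q = []
(a ∷ as) *P q = map (a ℤ.*_) q +P (0ℤ ∷ (as *P q))

const : ℤ → Poly
const c = c ∷ []

X : Poly
X = 0ℤ ∷ 1ℤ ∷ []

_^P_ : Poly → ℕ → Poly
h ^P zero  = const 1ℤ
h ^P suc n = h *P (h ^P n)

compose : Poly → Poly → Poly
compose f h = foldr (λ a acc → const a +P (h *P acc)) [] f

Monic : Poly → Set
Monic f = Σ ℕ λ d → coeff f d ≡ 1ℤ × (∀ m → d < m → coeff f m ≡ 0ℤ)

sumP : List Poly → Poly
sumP = foldr _+P_ []

⟨_⟩ : (Poly → Set) → Poly → Set
⟨ S ⟩ f = Σ (List (Poly × Poly)) λ cs →
            All (λ cs' → S (proj₂ cs')) cs ×
            (f ≈P sumP (map (λ cs' → proj₁ cs' *P proj₂ cs') cs))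

pair : Poly → Poly → Poly → Set
pair a b h = (h ≈P a) ⊎ (h ≈P b)

_·I_ : (Poly → Set) → (Poly → Set) → Poly → Set
(I ·I J) = ⟨ (λ h → Σ Poly λ a → Σ Poly λ b → I a × J b × (h ≈P a *P b)) ⟩

_≡P_[mod_] : Poly → Poly → ℤ → Set
f ≡P g [mod m ] = ∀ n → m ∣ℤ (coeff f n ℤ.- coeff g n)

UnitMod : ℕ → Poly → Set
UnitMod p a = Σ Poly λ c → (a *P c) ≡P const 1ℤ [mod + p ]

IrreducibleMod : ℕ → Poly → Set
IrreducibleMod p g =
  ¬ (g ≡P [] [mod + p ]) ×
  ¬ UnitMod p g ×
  (∀ a b → g ≡P a *P b [mod + p ] → UnitMod p a ⊎ UnitMod p b)

-- Write f = p·u + g²·v. Since ⟨p, g⟩² = ⟨p², p·g, g²⟩ and g is not a zero divisor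
-- modulo p, f ∈ ⟨p, g⟩² exactly when g divides u modulo p. The freshman's dream gives
-- the Frobenius congruence a(x^p) ≡ a(x)^p (mod p); applied to g it yields
-- f(x^p) = p·u′ + g²·v′ with u′ ≡ u(x^p) ≡ u^p modulo p and g. Finally g, being monic
-- and irreducible modulo p, is prime in 𝔽ₚ[x] (Euclid's algorithm), so g ∣ u^p iff g ∣ u.

module Submission where

open import Defs
open import Level using (0ℓ)
open import Data.Nat as ℕ using (ℕ; zero; suc; _≤_; _<_; _∸_; _!; s≤s; z≤n)
import Data.Nat.Properties as ℕ
import Data.Nat.Divisibility as ℕ
open import Data.Nat.DivMod using (m/n*n≡m)
open import Data.Nat.Induction using (<-rec)
open import Data.Nat.Primality using (Prime; euclidsLemma; prime⇒nonZero; prime⇒irreducible; ¬prime[0]; ¬prime[1])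
open import Data.Nat.Coprimality using (Coprime; coprime-Bézout)
open import Data.Nat.GCD using (module Bézout)
open import Data.Nat.Combinatorics using (_C_; nCn≡1; k![n∸k]!∣n!)
open import Data.Nat.Combinatorics.Specification using (nCk≡n!/k![n-k]!)
open import Data.Fin using (zero)
import Data.Fin.Properties as Fin
open import Data.Vec.Functional using (init; last; tail; replicate)
open import Data.Sum as Sum using (_⊎_; inj₁; inj₂)
open import Data.Empty using (⊥-elim)
open import Relation.Nullary using (¬_; yes; no)
open import Relation.Binary.PropositionalEquality as ≡ using (_≡_)
open import Algebra.Bundles using (CommutativeSemiring; CommutativeRing)
open import Function.Bundles using (_⇔_; mk⇔)

-- Binomial coefficients and the freshman's dream

nCk*k!*[n-k]!≡n! : ∀ {n k} → k ≤ n → (n C k) ℕ.* (k ! ℕ.* (n ∸ k) !) ≡ n !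
nCk*k!*[n-k]!≡n! {n} {k} k≤n = ≡.trans (≡.cong (ℕ._* (k ! ℕ.* (n ∸ k) !)) (nCk≡n!/k![n-k]! k≤n))
                                     (m/n*n≡m (k![n∸k]!∣n! k≤n))
  where instance _ = k ℕ.!* (n ∸ k) !≢0

n∣n! : ∀ {n} → 0 < n → n ℕ.∣ n !
n∣n! {suc n} _ = ℕ.m∣m*n (n !)

module _ {p : ℕ} (p-prime : Prime p) where

  prime∤! : ∀ {m} → m < p → ¬ (p ℕ.∣ m !)
  prime∤! {zero}  _     p∣1 = ¬prime[1] (≡.subst Prime (ℕ.∣1⇒≡1 p∣1) p-prime)
  prime∤! {suc m} m+1<p p∣m+1! with euclidsLemma (suc m) (m !) p-prime p∣m+1!
  ... | inj₁ p∣m+1 = ℕ.<⇒≱ m+1<p (ℕ.∣⇒≤ p∣m+1)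
  ... | inj₂ p∣m!  = prime∤! (ℕ.<-trans (ℕ.n<1+n m) m+1<p) p∣m!

  prime∣C : ∀ {k} → 0 < k → k < p → p ℕ.∣ (p C k)
  prime∣C {k} 0<k k<p
    with euclidsLemma (p C k) (k ! ℕ.* (p ∸ k) !) p-prime
           (≡.subst (p ℕ.∣_) (≡.sym (nCk*k!*[n-k]!≡n! (ℕ.<⇒≤ k<p))) (n∣n! (ℕ.<-trans 0<k k<p)))
  ... | inj₁ p∣C = p∣C
  ... | inj₂ p∣k!*[p-k]! with euclidsLemma (k !) ((p ∸ k) !) p-prime p∣k!*[p-k]!
  ...   | inj₁ p∣k!     = ⊥-elim (prime∤! k<p p∣k!)
  ...   | inj₂ p∣[p-k]! = ⊥-elim (prime∤! (ℕ.∸-monoʳ-< 0<k (ℕ.<⇒≤ k<p)) p∣[p-k]!)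

module _ {c ℓ} (R : CommutativeSemiring c ℓ) where
  open CommutativeSemiring R hiding (zero)
  open import Algebra.Properties.Semiring.Mult semiring using (_×_; ×-congʳ; ×-assoc-*; ×1-homo-*; ×-homo-1)
  open import Algebra.Properties.Semiring.Exp semiring using (_^_)
  open import Algebra.Properties.Semiring.Sum semiring using (sum; sum-cong-≋; sum-init-last; sum-replicate-zero)
  import Algebra.Properties.CommutativeSemiring.Binomial R as Binomial
  open import Relation.Binary.Reasoning.Setoid setoid

  1#^≈1# : ∀ n → 1# ^ n ≈ 1#
  1#^≈1# zero    = refl
  1#^≈1# (suc n) = trans (*-identityˡ (1# ^ n)) (1#^≈1# n)

  module _ {p : ℕ} (char-p : p × 1# ≈ 0#) where

    multiple×≈0 : ∀ {n} x → p ℕ.∣ n → n × x ≈ 0#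
    multiple×≈0 x (ℕ.divides q ≡.refl) = begin
      (q ℕ.* p) × x               ≈⟨ ×-congʳ (q ℕ.* p) (*-identityˡ x) ⟨
      (q ℕ.* p) × (1# * x)        ≈⟨ ×-assoc-* (q ℕ.* p) 1# x ⟨
      ((q ℕ.* p) × 1#) * x        ≈⟨ *-congʳ (trans (×1-homo-* q p) (*-congˡ char-p)) ⟩
      ((q × 1#) * 0#) * x         ≈⟨ *-congʳ (zeroʳ (q × 1#)) ⟩
      0# * x                      ≈⟨ zeroˡ x ⟩
      0#                          ∎

  freshman's-dream : ∀ {p} → Prime p → p × 1# ≈ 0# → ∀ x y → (x + y) ^ p ≈ x ^ p + y ^ p
  freshman's-dream {zero}  p-prime = ⊥-elim (¬prime[0] p-prime)
  freshman's-dream {suc q} p-prime char-p x y = begin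
    (x + y) ^ suc q
      ≈⟨ Binomial.theorem (suc q) x y ⟩
    t zero + sum (tail t)
      ≈⟨ +-congˡ (sum-init-last (tail t)) ⟩
    t zero + (sum (init (tail t)) + last (tail t))
      ≈⟨ +-cong first (+-cong middle (final _ (Fin.toℕ-fromℕ (suc q)))) ⟩
    y ^ suc q + (0# + x ^ suc q)
      ≈⟨ trans (+-congˡ (+-identityˡ _)) (+-comm _ _) ⟩
    x ^ suc q + y ^ suc q
      ∎
    where
    t = Binomial.binomialTerm x y (suc q)

    first : t zero ≈ y ^ suc q
    first = trans (×-homo-1 _) (*-identityˡ _)

    -- The terms with 0 < k < p vanish because p divides p C k.
    middle : sum (init (tail t)) ≈ 0#
    middle = trans (sum-cong-≋ {x = init (tail t)} {y = replicate q 0#} vanish) (sum-replicate-zero q)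
      where
      vanish : ∀ i → init (tail t) i ≈ 0#
      vanish i = multiple×≈0 char-p _ (prime∣C p-prime (s≤s z≤n)
        (s≤s (≡.subst (_< q) (≡.sym (Fin.toℕ-inject₁ i)) (Fin.toℕ<n i))))

    final : ∀ j → j ≡ suc q → (suc q C j) × (x ^ j * y ^ (suc q ∸ j)) ≈ x ^ suc q
    final j ≡.refl rewrite nCn≡1 (suc q) | ℕ.n∸n≡0 q = trans (×-homo-1 _) (*-identityʳ _)

  fermat : ∀ {p} → Prime p → p × 1# ≈ 0# → ∀ n → (n × 1#) ^ p ≈ n × 1#
  fermat {zero}  p-prime = ⊥-elim (¬prime[0] p-prime)
  fermat {suc q} p-prime char-p zero    = zeroˡ _
  fermat {suc q} p-prime char-p (suc n) = begin
    (1# + n × 1#) ^ suc q              ≈⟨ freshman's-dream p-prime char-p 1# (n × 1#) ⟩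
    1# ^ suc q + (n × 1#) ^ suc q      ≈⟨ +-cong (1#^≈1# (suc q)) (fermat p-prime char-p n) ⟩
    1# + n × 1#                        ∎

open import Data.Integer using (ℤ; +_; 0ℤ; 1ℤ; _+_; _*_; -_; _-_; NonZero) renaming (∣_∣ to abs)
import Data.Integer.Properties as ℤ
open import Data.Integer.DivMod using (_%ℕ_; _/ℕ_; a≡a%ℕn+[a/ℕn]*n)
open import Data.Integer.Divisibility.Signed
import Data.Integer.Tactic.RingSolver as ℤ-Solver
open import Data.List using ([]; _∷_; map)
open import Data.List.Relation.Unary.All using (All; []; _∷_)
open import Data.Maybe as Maybe using (Maybe; just; nothing)
open import Data.Product using (Σ; ∃; ∃₂; _×_; _,_; proj₁; proj₂)
open import Relation.Binary.Core using (Rel; _⇒_)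
open import Relation.Binary.Structures using (IsEquivalence)
open import Relation.Binary.Bundles using (Setoid)
import Relation.Binary.Reasoning.Setoid as SetoidReasoning
open import Relation.Binary.PropositionalEquality
open import Algebra.Structures using (IsCommutativeRing)
open import Algebra.Definitions using (Congruent₁; Congruent₂)
import Function.Properties.Equivalence as ⇔
open import Function.Related.Propositional using (module EquationalReasoning; Kind)
open import Tactic.RingSolver using (solve-∀)
open import Tactic.RingSolver.Core.AlmostCommutativeRing using (AlmostCommutativeRing; fromCommutativeRing)

-- The ring ℤ[x]

-- A record around _≈P_, so that both polynomials can be inferred from a proof.
infix 4 _≋_
record _≋_ (f g : Poly) : Set where
  constructor mk≋
  field coeff-≡ : f ≈P g
open _≋_ public

≋-isEquivalence : IsEquivalence _≋_
≋-isEquivalence = record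
  { refl  = mk≋ λ _ → refl
  ; sym   = λ e → mk≋ λ n → sym (coeff-≡ e n)
  ; trans = λ e e′ → mk≋ λ n → trans (coeff-≡ e n) (coeff-≡ e′ n)
  }

open IsEquivalence ≋-isEquivalence public
  using () renaming (refl to ≋-refl; sym to ≋-sym; trans to ≋-trans)

≋-setoid : Setoid 0ℓ 0ℓ
≋-setoid = record { isEquivalence = ≋-isEquivalence }

module ≋-Reasoning = SetoidReasoning ≋-setoid

infixl 6 _-P_
infixr 7 _·P_

negP : Poly → Poly
negP = map (λ a → - a)

_-P_ : Poly → Poly → Poly
f -P g = f +P negP g

_·P_ : ℤ → Poly → Poly
c ·P f = map (c *_) f

coeff-+P : ∀ f g n → coeff (f +P g) n ≡ coeff f n + coeff g n
coeff-+P []      g       n       = sym (ℤ.+-identityˡ _)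
coeff-+P (a ∷ f) []      n       = sym (ℤ.+-identityʳ _)
coeff-+P (a ∷ f) (b ∷ g) zero    = refl
coeff-+P (a ∷ f) (b ∷ g) (suc n) = coeff-+P f g n

coeff-map : ∀ {φ : ℤ → ℤ} → φ 0ℤ ≡ 0ℤ → ∀ f n → coeff (map φ f) n ≡ φ (coeff f n)
coeff-map φ0 []      n       = sym φ0
coeff-map φ0 (a ∷ f) zero    = refl
coeff-map φ0 (a ∷ f) (suc n) = coeff-map φ0 f n

coeff-negP : ∀ f n → coeff (negP f) n ≡ - coeff f n
coeff-negP = coeff-map refl

coeff--P : ∀ f g n → coeff (f -P g) n ≡ coeff f n - coeff g n
coeff--P f g n = trans (coeff-+P f (negP g) n) (cong (λ z → coeff f n + z) (coeff-negP g n))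

coeff-·P : ∀ c f n → coeff (c ·P f) n ≡ c * coeff f n
coeff-·P c = coeff-map (ℤ.*-zeroʳ c)

coeff-∷*P-zero : ∀ a f g → coeff ((a ∷ f) *P g) 0 ≡ a * coeff g 0
coeff-∷*P-zero a f g = trans (coeff-+P (a ·P g) _ 0) (trans (ℤ.+-identityʳ _) (coeff-·P a g 0))

coeff-∷*P-suc : ∀ a f g n →
  coeff ((a ∷ f) *P g) (suc n) ≡ a * coeff g (suc n) + coeff (f *P g) n
coeff-∷*P-suc a f g n = trans (coeff-+P (a ·P g) _ (suc n)) (cong (_+ _) (coeff-·P a g (suc n)))

+P-cong : Congruent₂ _≋_ _+P_
+P-cong {f} {f′} {g} {g′} e e′ = mk≋ λ n → begin
  coeff (f +P g) n            ≡⟨ coeff-+P f g n ⟩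
  coeff f n + coeff g n       ≡⟨ cong₂ _+_ (coeff-≡ e n) (coeff-≡ e′ n) ⟩
  coeff f′ n + coeff g′ n     ≡⟨ coeff-+P f′ g′ n ⟨
  coeff (f′ +P g′) n          ∎
  where open ≡-Reasoning

map-cong : ∀ (φ : ℤ → ℤ) → φ 0ℤ ≡ 0ℤ → Congruent₁ _≋_ (map φ)
map-cong φ φ0 {f} {f′} e = mk≋ λ n →
  trans (coeff-map φ0 f n) (trans (cong φ (coeff-≡ e n)) (sym (coeff-map φ0 f′ n)))

negP-cong : Congruent₁ _≋_ negP
negP-cong = map-cong (λ a → - a) refl

·P-cong : ∀ c → Congruent₁ _≋_ (c ·P_)
·P-cong c = map-cong (c *_) (ℤ.*-zeroʳ c)

∷-cong : ∀ a {f g} → f ≋ g → a ∷ f ≋ a ∷ g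
∷-cong a e = mk≋ λ { zero → refl ; (suc n) → coeff-≡ e n }

*P-congˡ : ∀ f {g g′} → g ≋ g′ → f *P g ≋ f *P g′
*P-congˡ []      e = ≋-refl
*P-congˡ (a ∷ f) e = +P-cong (·P-cong a e) (∷-cong 0ℤ (*P-congˡ f e))

+P-assoc : ∀ f g h → (f +P g) +P h ≋ f +P (g +P h)
+P-assoc f g h = mk≋ λ n → begin
  coeff ((f +P g) +P h) n
    ≡⟨ trans (coeff-+P (f +P g) h n) (cong (_+ coeff h n) (coeff-+P f g n)) ⟩
  coeff f n + coeff g n + coeff h n
    ≡⟨ ℤ.+-assoc (coeff f n) _ _ ⟩
  coeff f n + (coeff g n + coeff h n)
    ≡⟨ trans (coeff-+P f _ n) (cong (λ z → coeff f n + z) (coeff-+P g h n)) ⟨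
  coeff (f +P (g +P h)) n
    ∎
  where open ≡-Reasoning

+P-comm : ∀ f g → f +P g ≋ g +P f
+P-comm f g = mk≋ λ n →
  trans (coeff-+P f g n) (trans (ℤ.+-comm (coeff f n) _) (sym (coeff-+P g f n)))

+P-identityʳ : ∀ f → f +P [] ≋ f
+P-identityʳ f = mk≋ λ n → trans (coeff-+P f [] n) (ℤ.+-identityʳ _)

negP-inverseˡ : ∀ f → negP f +P f ≋ []
negP-inverseˡ f = mk≋ λ n →
  trans (coeff-+P (negP f) f n) (trans (cong (_+ coeff f n) (coeff-negP f n)) (ℤ.+-inverseˡ (coeff f n)))

negP-inverseʳ : ∀ f → f +P negP f ≋ []
negP-inverseʳ f = ≋-trans (+P-comm f (negP f)) (negP-inverseˡ f)

*P-zeroʳ : ∀ f → f *P [] ≋ []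
*P-zeroʳ []      = ≋-refl
*P-zeroʳ (a ∷ f) = mk≋ λ { zero → refl ; (suc n) → coeff-≡ (*P-zeroʳ f) n }

*P-distribˡ : ∀ f g h → f *P (g +P h) ≋ f *P g +P f *P h
*P-distribˡ []      g h = ≋-refl
*P-distribˡ (a ∷ f) g h = mk≋ λ where
    zero → begin
      coeff ((a ∷ f) *P (g +P h)) 0
        ≡⟨ coeff-∷*P-zero a f (g +P h) ⟩
      a * coeff (g +P h) 0
        ≡⟨ cong (a *_) (coeff-+P g h 0) ⟩
      a * (coeff g 0 + coeff h 0)
        ≡⟨ ℤ.*-distribˡ-+ a _ _ ⟩
      a * coeff g 0 + a * coeff h 0
        ≡⟨ cong₂ _+_ (coeff-∷*P-zero a f g) (coeff-∷*P-zero a f h) ⟨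
      coeff ((a ∷ f) *P g) 0 + coeff ((a ∷ f) *P h) 0
        ≡⟨ coeff-+P ((a ∷ f) *P g) _ 0 ⟨
      coeff ((a ∷ f) *P g +P (a ∷ f) *P h) 0
        ∎
    (suc n) → begin
      coeff ((a ∷ f) *P (g +P h)) (suc n)
        ≡⟨ coeff-∷*P-suc a f _ n ⟩
      a * coeff (g +P h) (suc n) + coeff (f *P (g +P h)) n
        ≡⟨ cong₂ (λ x y → a * x + y) (coeff-+P g h (suc n))
                 (trans (coeff-≡ (*P-distribˡ f g h) n) (coeff-+P (f *P g) (f *P h) n)) ⟩
      a * (coeff g (suc n) + coeff h (suc n)) + (coeff (f *P g) n + coeff (f *P h) n)
        ≡⟨ shuffle a _ _ _ _ ⟩
      (a * coeff g (suc n) + coeff (f *P g) n) + (a * coeff h (suc n) + coeff (f *P h) n)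
        ≡⟨ cong₂ _+_ (coeff-∷*P-suc a f g n) (coeff-∷*P-suc a f h n) ⟨
      coeff ((a ∷ f) *P g) (suc n) + coeff ((a ∷ f) *P h) (suc n)
        ≡⟨ coeff-+P ((a ∷ f) *P g) _ (suc n) ⟨
      coeff ((a ∷ f) *P g +P (a ∷ f) *P h) (suc n) ∎
  where
  open ≡-Reasoning
  shuffle : ∀ a b c x y → a * (b + c) + (x + y) ≡ (a * b + x) + (a * c + y)
  shuffle = ℤ-Solver.solve-∀

·P-identity : ∀ f → 1ℤ ·P f ≋ f
·P-identity f = mk≋ λ n → trans (coeff-·P 1ℤ f n) (ℤ.*-identityˡ _)

·P-zero : ∀ f → 0ℤ ·P f ≋ []
·P-zero f = mk≋ λ n → trans (coeff-·P 0ℤ f n) (ℤ.*-zeroˡ (coeff f n))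

∷-split : ∀ a f → a ∷ f ≋ const a +P (0ℤ ∷ f)
∷-split a f = mk≋ λ { zero → sym (ℤ.+-identityʳ a) ; (suc n) → refl }

*P-constʳ : ∀ f c → f *P const c ≋ c ·P f
*P-constʳ []      c = ≋-refl
*P-constʳ (a ∷ f) c = mk≋ λ where
  zero    → trans (ℤ.+-identityʳ _) (ℤ.*-comm a c)
  (suc n) → coeff-≡ (*P-constʳ f c) n

*P-shiftʳ : ∀ f g → f *P (0ℤ ∷ g) ≋ 0ℤ ∷ (f *P g)
*P-shiftʳ []      g = mk≋ λ { zero → refl ; (suc n) → refl }
*P-shiftʳ (a ∷ f) g = mk≋ λ where
  zero    → cong (_+ 0ℤ) (ℤ.*-zeroʳ a)
  (suc n) → coeff-≡ (+P-cong (≋-refl {a ·P g}) (*P-shiftʳ f g)) n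

*P-shiftˡ : ∀ f g → (0ℤ ∷ f) *P g ≋ 0ℤ ∷ (f *P g)
*P-shiftˡ f g = +P-cong (·P-zero g) (≋-refl {0ℤ ∷ f *P g})

*P-comm : ∀ f g → f *P g ≋ g *P f
*P-comm f []      = *P-zeroʳ f
*P-comm f (b ∷ g) = begin
  f *P (b ∷ g)                    ≈⟨ *P-congˡ f (∷-split b g) ⟩
  f *P (const b +P (0ℤ ∷ g))      ≈⟨ *P-distribˡ f (const b) (0ℤ ∷ g) ⟩
  f *P const b +P f *P (0ℤ ∷ g)   ≈⟨ +P-cong (*P-constʳ f b) (*P-shiftʳ f g) ⟩
  b ·P f +P (0ℤ ∷ f *P g)         ≈⟨ +P-cong (≋-refl {b ·P f}) (∷-cong 0ℤ (*P-comm f g)) ⟩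
  b ·P f +P (0ℤ ∷ g *P f)         ∎
  where open ≋-Reasoning

*P-distribʳ : ∀ f g h → (g +P h) *P f ≋ g *P f +P h *P f
*P-distribʳ f g h = begin
  (g +P h) *P f          ≈⟨ *P-comm (g +P h) f ⟩
  f *P (g +P h)          ≈⟨ *P-distribˡ f g h ⟩
  f *P g +P f *P h       ≈⟨ +P-cong (*P-comm f g) (*P-comm f h) ⟩
  g *P f +P h *P f       ∎
  where open ≋-Reasoning

*P-congʳ : ∀ f {g g′} → g ≋ g′ → g *P f ≋ g′ *P f
*P-congʳ f {g} {g′} e = ≋-trans (*P-comm g f) (≋-trans (*P-congˡ f e) (*P-comm f g′))

*P-cong : Congruent₂ _≋_ _*P_
*P-cong {f} {f′} {g} e e′ = ≋-trans (*P-congʳ g e) (*P-congˡ f′ e′)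

·P-*P-assoc : ∀ c f g → (c ·P f) *P g ≋ c ·P (f *P g)
·P-*P-assoc c []      g = ≋-refl
·P-*P-assoc c (a ∷ f) g = mk≋ λ where
    zero → begin
      coeff ((c * a ∷ c ·P f) *P g) 0     ≡⟨ coeff-∷*P-zero (c * a) (c ·P f) g ⟩
      c * a * coeff g 0                   ≡⟨ ℤ.*-assoc c a _ ⟩
      c * (a * coeff g 0)                 ≡⟨ cong (c *_) (coeff-∷*P-zero a f g) ⟨
      c * coeff ((a ∷ f) *P g) 0          ≡⟨ coeff-·P c ((a ∷ f) *P g) 0 ⟨
      coeff (c ·P ((a ∷ f) *P g)) 0       ∎
    (suc n) → begin
      coeff ((c * a ∷ c ·P f) *P g) (suc n)
        ≡⟨ coeff-∷*P-suc (c * a) (c ·P f) g n ⟩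
      c * a * coeff g (suc n) + coeff ((c ·P f) *P g) n
        ≡⟨ cong (λ z → c * a * coeff g (suc n) + z)
                (trans (coeff-≡ (·P-*P-assoc c f g) n) (coeff-·P c (f *P g) n)) ⟩
      c * a * coeff g (suc n) + c * coeff (f *P g) n
        ≡⟨ factor c a _ _ ⟩
      c * (a * coeff g (suc n) + coeff (f *P g) n)
        ≡⟨ cong (c *_) (coeff-∷*P-suc a f g n) ⟨
      c * coeff ((a ∷ f) *P g) (suc n)
        ≡⟨ coeff-·P c ((a ∷ f) *P g) (suc n) ⟨
      coeff (c ·P ((a ∷ f) *P g)) (suc n) ∎
  where
  open ≡-Reasoning
  factor : ∀ c a x y → c * a * x + c * y ≡ c * (a * x + y)
  factor = ℤ-Solver.solve-∀

*P-assoc : ∀ f g h → (f *P g) *P h ≋ f *P (g *P h)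
*P-assoc []      g h = ≋-refl
*P-assoc (a ∷ f) g h = begin
  (a ·P g +P (0ℤ ∷ f *P g)) *P h
    ≈⟨ *P-distribʳ h (a ·P g) (0ℤ ∷ f *P g) ⟩
  (a ·P g) *P h +P (0ℤ ∷ f *P g) *P h
    ≈⟨ +P-cong (·P-*P-assoc a g h) (*P-shiftˡ (f *P g) h) ⟩
  a ·P (g *P h) +P (0ℤ ∷ (f *P g) *P h)
    ≈⟨ +P-cong (≋-refl {a ·P (g *P h)}) (∷-cong 0ℤ (*P-assoc f g h)) ⟩
  a ·P (g *P h) +P (0ℤ ∷ f *P (g *P h))
    ∎
  where open ≋-Reasoning

*P-identityʳ : ∀ f → f *P const 1ℤ ≋ f
*P-identityʳ f = ≋-trans (*P-constʳ f 1ℤ) (·P-identity f)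

*P-identityˡ : ∀ f → const 1ℤ *P f ≋ f
*P-identityˡ f = ≋-trans (*P-comm (const 1ℤ) f) (*P-identityʳ f)

const-*P : ∀ c f → const c *P f ≋ c ·P f
const-*P c f = ≋-trans (*P-comm (const c) f) (*P-constʳ f c)

coeff-const*P : ∀ c f n → coeff (const c *P f) n ≡ c * coeff f n
coeff-const*P c f n = trans (coeff-≡ (const-*P c f) n) (coeff-·P c f n)

const*P-cancelˡ : ∀ c .{{_ : NonZero c}} {f g} → const c *P f ≋ const c *P g → f ≋ g
const*P-cancelˡ c {f} {g} e = mk≋ λ n → ℤ.*-cancelˡ-≡ c (coeff f n) (coeff g n)
  (trans (sym (coeff-const*P c f n)) (trans (coeff-≡ e n) (coeff-const*P c g n)))

module _ {_∼_ : Rel Poly 0ℓ} (isEquivalence : IsEquivalence _∼_) (≋⇒∼ : _≋_ ⇒ _∼_)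
         (+-cong : Congruent₂ _∼_ _+P_) (*-cong : Congruent₂ _∼_ _*P_) (neg-cong : Congruent₁ _∼_ negP)
         where

  isCommutativeRing-coarser : IsCommutativeRing _∼_ _+P_ _*P_ negP [] (const 1ℤ)
  isCommutativeRing-coarser = record
    { isRing = record
      { +-isAbelianGroup = record
        { isGroup = record
          { isMonoid = record
            { isSemigroup = record
              { isMagma = record { isEquivalence = isEquivalence ; ∙-cong = +-cong }
              ; assoc   = λ f g h → ≋⇒∼ (+P-assoc f g h) }
            ; identity = (λ f → ≋⇒∼ (≋-refl {f})) , (λ f → ≋⇒∼ (+P-identityʳ f)) }
          ; inverse = (λ f → ≋⇒∼ (negP-inverseˡ f)) , (λ f → ≋⇒∼ (negP-inverseʳ f))
          ; ⁻¹-cong = neg-cong }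
        ; comm = λ f g → ≋⇒∼ (+P-comm f g) }
      ; *-cong     = *-cong
      ; *-assoc    = λ f g h → ≋⇒∼ (*P-assoc f g h)
      ; *-identity = (λ f → ≋⇒∼ (*P-identityˡ f)) , (λ f → ≋⇒∼ (*P-identityʳ f))
      ; distrib    = (λ f g h → ≋⇒∼ (*P-distribˡ f g h)) , (λ f g h → ≋⇒∼ (*P-distribʳ f g h)) }
    ; *-comm = λ f g → ≋⇒∼ (*P-comm f g) }

  commutativeRing-coarser : CommutativeRing 0ℓ 0ℓ
  commutativeRing-coarser = record { isCommutativeRing = isCommutativeRing-coarser }

ℤ[x]-commutativeRing : CommutativeRing 0ℓ 0ℓ
ℤ[x]-commutativeRing = commutativeRing-coarser ≋-isEquivalence (λ e → e) +P-cong *P-cong negP-cong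

-- The zero test lets the ring solver discard vanishing coefficients.
[]≋? : ∀ f → Maybe ([] ≋ f)
[]≋? []         = just ≋-refl
[]≋? (+ 0 ∷ f)  = Maybe.map (λ e → mk≋ λ { zero → refl ; (suc n) → coeff-≡ e n }) ([]≋? f)
[]≋? _          = nothing

ℤ[x] : AlmostCommutativeRing 0ℓ 0ℓ
ℤ[x] = fromCommutativeRing ℤ[x]-commutativeRing []≋?

-- Congruences modulo an integer

infix 4 _∣ᴾ_
record _∣ᴾ_ (m : ℤ) (h : Poly) : Set where
  constructor mk∣ᴾ
  field coeff-∣ : ∀ n → m ∣ coeff h n
open _∣ᴾ_ public

module _ {m : ℤ} where

  ∣0 : m ∣ 0ℤ
  ∣0 = divides 0ℤ refl

  ∣ᴾ-resp-≋ : ∀ {f g} → f ≋ g → m ∣ᴾ f → m ∣ᴾ g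
  ∣ᴾ-resp-≋ e d = mk∣ᴾ λ n → subst (m ∣_) (coeff-≡ e n) (coeff-∣ d n)

  ∣ᴾ-[] : m ∣ᴾ []
  ∣ᴾ-[] = mk∣ᴾ λ _ → ∣0

  ∣ᴾ-∷ : ∀ {a f} → m ∣ a → m ∣ᴾ f → m ∣ᴾ a ∷ f
  ∣ᴾ-∷ d ds = mk∣ᴾ λ { zero → d ; (suc n) → coeff-∣ ds n }

  ∣ᴾ-+P : ∀ {f g} → m ∣ᴾ f → m ∣ᴾ g → m ∣ᴾ f +P g
  ∣ᴾ-+P {f} {g} d e = mk∣ᴾ λ n →
    subst (m ∣_) (sym (coeff-+P f g n)) (∣m∣n⇒∣m+n (coeff-∣ d n) (coeff-∣ e n))

  ∣ᴾ-negP : ∀ {f} → m ∣ᴾ f → m ∣ᴾ negP f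
  ∣ᴾ-negP {f} d = mk∣ᴾ λ n → subst (m ∣_) (sym (coeff-negP f n)) (∣m⇒∣-m (coeff-∣ d n))

  ∣ᴾ-·P : ∀ c {f} → m ∣ᴾ f → m ∣ᴾ c ·P f
  ∣ᴾ-·P c {f} d = mk∣ᴾ λ n → subst (m ∣_) (sym (coeff-·P c f n)) (∣n⇒∣m*n c (coeff-∣ d n))

  ∣ᴾ-*Pˡ : ∀ f {h} → m ∣ᴾ h → m ∣ᴾ f *P h
  ∣ᴾ-*Pˡ []      d = ∣ᴾ-[]
  ∣ᴾ-*Pˡ (a ∷ f) d = ∣ᴾ-+P (∣ᴾ-·P a d) (∣ᴾ-∷ ∣0 (∣ᴾ-*Pˡ f d))

  ∣ᴾ-*Pʳ : ∀ {h} f → m ∣ᴾ h → m ∣ᴾ h *P f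
  ∣ᴾ-*Pʳ {h} f d = ∣ᴾ-resp-≋ (*P-comm f h) (∣ᴾ-*Pˡ f d)

  ∣ᴾ-const*P : ∀ e → m ∣ᴾ const m *P e
  ∣ᴾ-const*P e = ∣ᴾ-resp-≋ (≋-sym (const-*P m e))
    (mk∣ᴾ λ n → subst (m ∣_) (sym (coeff-·P m e n)) (∣m⇒∣m*n (coeff e n) ∣-refl))

  ∣ᴾ⇒·P : ∀ {h} → m ∣ᴾ h → ∃ λ e → h ≋ m ·P e
  ∣ᴾ⇒·P {[]}    d = [] , ≋-refl
  ∣ᴾ⇒·P {a ∷ h} d with ∣ᴾ⇒·P {h} (mk∣ᴾ λ n → coeff-∣ d (suc n)) | coeff-∣ d 0
  ... | e , h≋ | divides q a≡ = q ∷ e , mk≋ λ where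
    zero    → trans a≡ (ℤ.*-comm q m)
    (suc n) → coeff-≡ h≋ n

  ∣ᴾ⇒const*P : ∀ {h} → m ∣ᴾ h → ∃ λ e → h ≋ const m *P e
  ∣ᴾ⇒const*P d with ∣ᴾ⇒·P d
  ... | e , h≋ = e , ≋-trans h≋ (≋-sym (const-*P m e))

infix 4 _≡ᴾ_[mod_]
record _≡ᴾ_[mod_] (f g : Poly) (m : ℤ) : Set where
  constructor mk≡ᴾ
  field ∣ᴾ-diff : m ∣ᴾ f -P g
open _≡ᴾ_[mod_] public

module _ {m : ℤ} where

  ≋⇒≡ᴾ : ∀ {f g} → f ≋ g → f ≡ᴾ g [mod m ]
  ≋⇒≡ᴾ {f} {g} e = mk≡ᴾ (∣ᴾ-resp-≋ (≋-sym (≋-trans (+P-cong e ≋-refl) (negP-inverseʳ g))) ∣ᴾ-[])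

  ≡ᴾ-isEquivalence : IsEquivalence _≡ᴾ_[mod m ]
  ≡ᴾ-isEquivalence = record
    { refl  = ≋⇒≡ᴾ ≋-refl
    ; sym   = λ {f} {g} e →
                mk≡ᴾ (∣ᴾ-resp-≋ (sym-diff f g) (∣ᴾ-negP (∣ᴾ-diff e)))
    ; trans = λ {f} {g} {h} e e′ →
                mk≡ᴾ (∣ᴾ-resp-≋ (trans-diff f g h) (∣ᴾ-+P (∣ᴾ-diff e) (∣ᴾ-diff e′)))
    }
    where
    sym-diff : ∀ f g → negP (f -P g) ≋ g -P f
    sym-diff = solve-∀ ℤ[x]
    trans-diff : ∀ f g h → (f -P g) +P (g -P h) ≋ f -P h
    trans-diff = solve-∀ ℤ[x]

  +P-cong-≡ᴾ : ∀ {f f′ g g′} → f ≡ᴾ f′ [mod m ] → g ≡ᴾ g′ [mod m ] →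
               f +P g ≡ᴾ f′ +P g′ [mod m ]
  +P-cong-≡ᴾ {f} {f′} {g} {g′} e e′ =
    mk≡ᴾ (∣ᴾ-resp-≋ (diff f f′ g g′) (∣ᴾ-+P (∣ᴾ-diff e) (∣ᴾ-diff e′)))
    where
    diff : ∀ f f′ g g′ → (f -P f′) +P (g -P g′) ≋ (f +P g) -P (f′ +P g′)
    diff = solve-∀ ℤ[x]

  *P-cong-≡ᴾ : ∀ {f f′ g g′} → f ≡ᴾ f′ [mod m ] → g ≡ᴾ g′ [mod m ] →
               f *P g ≡ᴾ f′ *P g′ [mod m ]
  *P-cong-≡ᴾ {f} {f′} {g} {g′} e e′ =
    mk≡ᴾ (∣ᴾ-resp-≋ (diff f f′ g g′) (∣ᴾ-+P (∣ᴾ-*Pʳ g (∣ᴾ-diff e)) (∣ᴾ-*Pˡ f′ (∣ᴾ-diff e′))))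
    where
    diff : ∀ f f′ g g′ → (f -P f′) *P g +P f′ *P (g -P g′) ≋ f *P g -P f′ *P g′
    diff = solve-∀ ℤ[x]

  negP-cong-≡ᴾ : ∀ {f f′} → f ≡ᴾ f′ [mod m ] → negP f ≡ᴾ negP f′ [mod m ]
  negP-cong-≡ᴾ {f} {f′} e = mk≡ᴾ (∣ᴾ-resp-≋ (diff f f′) (∣ᴾ-negP (∣ᴾ-diff e)))
    where
    diff : ∀ f f′ → negP (f -P f′) ≋ negP f -P negP f′
    diff = solve-∀ ℤ[x]

ℤ/_[x] : ℤ → CommutativeRing 0ℓ 0ℓ
ℤ/ m [x] = commutativeRing-coarser (≡ᴾ-isEquivalence {m}) ≋⇒≡ᴾ +P-cong-≡ᴾ *P-cong-≡ᴾ negP-cong-≡ᴾ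

module ≡ᴾ-Reasoning (m : ℤ) = SetoidReasoning (CommutativeRing.setoid ℤ/ m [x])

module _ {m : ℤ} where
  open IsEquivalence (≡ᴾ-isEquivalence {m}) public
    using () renaming (refl to ≡ᴾ-refl; sym to ≡ᴾ-sym; trans to ≡ᴾ-trans)

  ∣ᴾ⇒≡ᴾ[] : ∀ {h} → m ∣ᴾ h → h ≡ᴾ [] [mod m ]
  ∣ᴾ⇒≡ᴾ[] {h} d = mk≡ᴾ (∣ᴾ-resp-≋ (≋-sym (+P-identityʳ h)) d)

  ≡ᴾ[]⇒∣ᴾ : ∀ {h} → h ≡ᴾ [] [mod m ] → m ∣ᴾ h
  ≡ᴾ[]⇒∣ᴾ {h} e = ∣ᴾ-resp-≋ (+P-identityʳ h) (∣ᴾ-diff e)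

  ≡ᴾ⇒≋+const*P : ∀ {f g} → f ≡ᴾ g [mod m ] → ∃ λ e → f ≋ g +P const m *P e
  ≡ᴾ⇒≋+const*P {f} {g} e with ∣ᴾ⇒const*P (∣ᴾ-diff e)
  ... | q , f-g≋ = q , ≋-trans (split f g) (+P-cong (≋-refl {g}) f-g≋)
    where
    split : ∀ f g → f ≋ g +P (f -P g)
    split = solve-∀ ℤ[x]

  ≋+const*P⇒≡ᴾ : ∀ {f g} e → f ≋ g +P const m *P e → f ≡ᴾ g [mod m ]
  ≋+const*P⇒≡ᴾ {f} {g} e f≋ = mk≡ᴾ (∣ᴾ-resp-≋ (≋-sym (diff f g (const m *P e) f≋)) (∣ᴾ-const*P e))
    where
    cancel : ∀ g x → (g +P x) -P g ≋ x
    cancel = solve-∀ ℤ[x]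
    diff : ∀ f g x → f ≋ g +P x → f -P g ≋ x
    diff f g x f≋ = ≋-trans (+P-cong f≋ ≋-refl) (cancel g x)

  ≡ᴾ⇒≡P : ∀ {f g} → f ≡ᴾ g [mod m ] → f ≡P g [mod m ]
  ≡ᴾ⇒≡P {f} {g} e n = ∣⇒∣ᵤ (subst (m ∣_) (coeff--P f g n) (coeff-∣ (∣ᴾ-diff e) n))

  ≡P⇒≡ᴾ : ∀ {f g} → f ≡P g [mod m ] → f ≡ᴾ g [mod m ]
  ≡P⇒≡ᴾ {f} {g} e = mk≡ᴾ (mk∣ᴾ λ n → subst (m ∣_) (sym (coeff--P f g n)) (∣ᵤ⇒∣ (e n)))

infix 4 _∣ᴾ_[mod_]
record _∣ᴾ_[mod_] (g a : Poly) (m : ℤ) : Set where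
  constructor divides
  field
    quotient : Poly
    equality : a ≡ᴾ g *P quotient [mod m ]

module _ {m : ℤ} where
  open ≡ᴾ-Reasoning m

  ∷-cong-≡ᴾ : ∀ a {f g} → f ≡ᴾ g [mod m ] → a ∷ f ≡ᴾ a ∷ g [mod m ]
  ∷-cong-≡ᴾ a e = mk≡ᴾ (∣ᴾ-∷ (subst (m ∣_) (sym (ℤ.+-inverseʳ a)) ∣0) (∣ᴾ-diff e))

  *P-congˡ-≡ᴾ : ∀ f {g g′} → g ≡ᴾ g′ [mod m ] → f *P g ≡ᴾ f *P g′ [mod m ]
  *P-congˡ-≡ᴾ f = *P-cong-≡ᴾ (≋⇒≡ᴾ (≋-refl {f}))

  *P-congʳ-≡ᴾ : ∀ f {g g′} → g ≡ᴾ g′ [mod m ] → g *P f ≡ᴾ g′ *P f [mod m ]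
  *P-congʳ-≡ᴾ f e = *P-cong-≡ᴾ e (≋⇒≡ᴾ (≋-refl {f}))

  -P-cong-≡ᴾ : ∀ {f f′ g g′} → f ≡ᴾ f′ [mod m ] → g ≡ᴾ g′ [mod m ] →
               f -P g ≡ᴾ f′ -P g′ [mod m ]
  -P-cong-≡ᴾ e e′ = +P-cong-≡ᴾ e (negP-cong-≡ᴾ e′)

  +P-≡ᴾ-transpose : ∀ {a b c} → a ≡ᴾ b +P c [mod m ] → c ≡ᴾ a -P b [mod m ]
  +P-≡ᴾ-transpose {a} {b} {c} a≡b+c = begin
    c                ≈⟨ ≋⇒≡ᴾ (cancel b c) ⟨
    (b +P c) -P b    ≈⟨ -P-cong-≡ᴾ a≡b+c (≋⇒≡ᴾ (≋-refl {b})) ⟨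
    a -P b           ∎
    where
    cancel : ∀ b c → (b +P c) -P b ≋ c
    cancel = solve-∀ ℤ[x]

module _ {m : ℤ} {g : Poly} where
  open ≡ᴾ-Reasoning m

  ∣ᴾ-mod-self : ∀ w → g ∣ᴾ g *P w [mod m ]
  ∣ᴾ-mod-self w = divides w ≡ᴾ-refl

  ∣ᴾ-mod-resp : ∀ {a b} → a ≡ᴾ b [mod m ] → g ∣ᴾ a [mod m ] → g ∣ᴾ b [mod m ]
  ∣ᴾ-mod-resp a≡b (divides w a≡gw) = divides w (≡ᴾ-trans (≡ᴾ-sym a≡b) a≡gw)

  ∣ᴾ-mod-*Pˡ : ∀ y {x} → g ∣ᴾ x [mod m ] → g ∣ᴾ y *P x [mod m ]
  ∣ᴾ-mod-*Pˡ y {x} (divides w x≡gw) = divides (y *P w) (begin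
    y *P x          ≈⟨ *P-congˡ-≡ᴾ y x≡gw ⟩
    y *P (g *P w)   ≈⟨ ≋⇒≡ᴾ (swap y g w) ⟩
    g *P (y *P w)   ∎)
    where
    swap : ∀ y g w → y *P (g *P w) ≋ g *P (y *P w)
    swap = solve-∀ ℤ[x]

  ∣ᴾ-mod-*Pʳ : ∀ y {x} → g ∣ᴾ x [mod m ] → g ∣ᴾ x *P y [mod m ]
  ∣ᴾ-mod-*Pʳ y {x} g∣x = ∣ᴾ-mod-resp (≋⇒≡ᴾ (*P-comm y x)) (∣ᴾ-mod-*Pˡ y g∣x)

  ∣ᴾ-mod--P : ∀ {x y} → g ∣ᴾ x [mod m ] → g ∣ᴾ y [mod m ] → g ∣ᴾ x -P y [mod m ]
  ∣ᴾ-mod--P {x} {y} (divides w x≡gw) (divides w′ y≡gw′) = divides (w -P w′) (begin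
    x -P y                   ≈⟨ -P-cong-≡ᴾ x≡gw y≡gw′ ⟩
    g *P w -P g *P w′        ≈⟨ ≋⇒≡ᴾ (factor g w w′) ⟩
    g *P (w -P w′)           ∎)
    where
    factor : ∀ g w w′ → g *P w -P g *P w′ ≋ g *P (w -P w′)
    factor = solve-∀ ℤ[x]

  ∣ᴾ-mod-+P : ∀ {x y} → g ∣ᴾ x [mod m ] → g ∣ᴾ y [mod m ] → g ∣ᴾ x +P y [mod m ]
  ∣ᴾ-mod-+P {x} {y} (divides w x≡gw) (divides w′ y≡gw′) = divides (w +P w′) (begin
    x +P y                   ≈⟨ +P-cong-≡ᴾ x≡gw y≡gw′ ⟩
    g *P w +P g *P w′        ≈⟨ ≋⇒≡ᴾ (*P-distribˡ g w w′) ⟨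
    g *P (w +P w′)           ∎)

  ∣ᴾ-mod-resp⇔ : ∀ {a b} → a ≡ᴾ b [mod m ] → (g ∣ᴾ a [mod m ] ⇔ g ∣ᴾ b [mod m ])
  ∣ᴾ-mod-resp⇔ a≡b = mk⇔ (∣ᴾ-mod-resp a≡b) (∣ᴾ-mod-resp (≡ᴾ-sym a≡b))

  ∣ᴾ-mod-+P-multiple⇔ : ∀ x y → g ∣ᴾ x [mod m ] ⇔ g ∣ᴾ x +P g *P y [mod m ]
  ∣ᴾ-mod-+P-multiple⇔ x y = mk⇔
    (λ g∣x → ∣ᴾ-mod-+P g∣x (∣ᴾ-mod-self y))
    (λ g∣x+gy → ∣ᴾ-mod-resp (≋⇒≡ᴾ (cancel x (g *P y))) (∣ᴾ-mod--P g∣x+gy (∣ᴾ-mod-self y)))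
    where
    cancel : ∀ x z → (x +P z) -P z ≋ x
    cancel = solve-∀ ℤ[x]

module _ {p : ℕ} (p-prime : Prime p) where

  prime∤1 : ¬ (+ p ∣ 1ℤ)
  prime∤1 d with ℕ.∣1⇒≡1 (∣⇒∣ᵤ d)
  ... | refl = ¬prime[1] p-prime

  euclidsLemmaℤ : ∀ a b → + p ∣ a * b → + p ∣ a ⊎ + p ∣ b
  euclidsLemmaℤ a b d =
    Sum.map ∣ᵤ⇒∣ ∣ᵤ⇒∣ (euclidsLemma (abs a) (abs b) p-prime (subst (p ℕ.∣_) (ℤ.abs-* a b) (∣⇒∣ᵤ d)))

  prime∤⇒coprime : ∀ {n} → ¬ (p ℕ.∣ n) → Coprime p n
  prime∤⇒coprime p∤n (d∣p , d∣n) with prime⇒irreducible p-prime d∣p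
  ... | inj₁ d≡1 = d≡1
  ... | inj₂ refl = ⊥-elim (p∤n d∣n)

  inverseModℕ : ∀ {n} → ¬ (p ℕ.∣ n) → ∃ λ t → + p ∣ t * + n - 1ℤ
  inverseModℕ {n} p∤n with coprime-Bézout (prime∤⇒coprime p∤n)
  ... | Bézout.-+ x y eq = + y , divides (+ x) (begin
    + y * + n - 1ℤ         ≡⟨ cong (_- 1ℤ) (ℤ.pos-* y n) ⟨
    + (y ℕ.* n) - 1ℤ       ≡⟨ cong (λ z → + z - 1ℤ) eq ⟨
    + (x ℕ.* p)            ≡⟨ ℤ.pos-* x p ⟩
    + x * + p              ∎)
    where open ≡-Reasoning
  ... | Bézout.+- x y eq = - + y , divides (- + x) (begin
    - + y * + n - 1ℤ       ≡⟨ negate (+ y) (+ n) ⟩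
    - (1ℤ + + y * + n)     ≡⟨ cong (λ z → - (1ℤ + z)) (ℤ.pos-* y n) ⟨
    - + (1 ℕ.+ y ℕ.* n)    ≡⟨ cong (λ z → - + z) eq ⟩
    - + (x ℕ.* p)          ≡⟨ cong -_ (ℤ.pos-* x p) ⟩
    - (+ x * + p)          ≡⟨ ℤ.neg-distribˡ-* (+ x) (+ p) ⟩
    - + x * + p            ∎)
    where
    open ≡-Reasoning
    negate : ∀ y n → - y * n - 1ℤ ≡ - (1ℤ + y * n)
    negate = ℤ-Solver.solve-∀

  inverseMod : ∀ c → ¬ (+ p ∣ c) → ∃ λ t → + p ∣ t * c - 1ℤ
  inverseMod c p∤c with inverseModℕ {abs c} (λ d → p∤c (∣ᵤ⇒∣ d)) | ℤ.+∣i∣≡i⊎+∣i∣≡-i c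
  ... | t , d | inj₁ ∣c∣≡c  = t , subst (λ z → + p ∣ t * z - 1ℤ) ∣c∣≡c d
  ... | t , d | inj₂ ∣c∣≡-c = - t , subst (λ z → + p ∣ z - 1ℤ) (trans (cong (t *_) ∣c∣≡-c) (flip t c)) d
    where
    flip : ∀ t c → t * - c ≡ - t * c
    flip = ℤ-Solver.solve-∀

∣m∣m-n⇒∣n : ∀ {m x y} → m ∣ x → m ∣ x - y → m ∣ y
∣m∣m-n⇒∣n {y = y} m∣x m∣x-y =
  subst (_ ∣_) (ℤ.neg-involutive y) (∣m⇒∣-m (∣m+n∣m⇒∣n m∣x-y m∣x))

infix 4 _∣ᴾ_from_
_∣ᴾ_from_ : ℤ → Poly → ℕ → Set
m ∣ᴾ h from k = ∀ i → k ≤ i → m ∣ coeff h i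

record DegreeMod (m : ℤ) (h : Poly) (j : ℕ) : Set where
  constructor degreeMod
  field
    leading : ¬ (m ∣ coeff h j)
    above   : m ∣ᴾ h from suc j

record MonicMod (m : ℤ) (h : Poly) (j : ℕ) : Set where
  constructor monicMod
  field
    leading : m ∣ coeff h j - 1ℤ
    above   : m ∣ᴾ h from suc j

∣ᴾ⊎degreeMod : ∀ m h → m ∣ᴾ h ⊎ ∃ (DegreeMod m h)
∣ᴾ⊎degreeMod m []      = inj₁ ∣ᴾ-[]
∣ᴾ⊎degreeMod m (a ∷ h) with ∣ᴾ⊎degreeMod m h
... | inj₂ (j , degreeMod m∤hⱼ h↑) = inj₂ (suc j , degreeMod m∤hⱼ λ { (suc i) (s≤s j<i) → h↑ i j<i })
... | inj₁ m∣h with m ∣? a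
...   | yes m∣a = inj₁ (∣ᴾ-∷ m∣a m∣h)
...   | no  m∤a = inj₂ (0 , degreeMod m∤a λ { (suc i) _ → coeff-∣ m∣h i })

monic⇒monicMod : ∀ {m h} → Monic h → ∃ (MonicMod m h)
monic⇒monicMod {m} (d , h_d≡1 , h↑≡0) = d , monicMod
  (subst (λ z → m ∣ z - 1ℤ) (sym h_d≡1) ∣0) (λ i d<i → subst (m ∣_) (sym (h↑≡0 i d<i)) ∣0)

module _ {m : ℤ} where

  coeff-*P-leading : ∀ e h j i → m ∣ᴾ e from suc j → m ∣ᴾ h from suc i →
                     m ∣ coeff (e *P h) (j ℕ.+ i) - coeff e j * coeff h i
  coeff-*P-leading []      h j       i       _  _  = ∣0
  coeff-*P-leading (a ∷ e) h zero    zero    _  _  = subst (m ∣_) (sym eq) ∣0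
    where
    eq : coeff ((a ∷ e) *P h) 0 - a * coeff h 0 ≡ 0ℤ
    eq = trans (cong (_- a * coeff h 0) (coeff-∷*P-zero a e h)) (ℤ.+-inverseʳ (a * coeff h 0))
  coeff-*P-leading (a ∷ e) h zero    (suc i) e↑ _  =
    subst (m ∣_) (sym eq) (coeff-∣ (∣ᴾ-*Pʳ {h = e} h (mk∣ᴾ λ k → e↑ (suc k) (s≤s z≤n))) i)
    where
    cancel : ∀ x y → x + y - x ≡ y
    cancel = ℤ-Solver.solve-∀
    eq : coeff ((a ∷ e) *P h) (suc i) - a * coeff h (suc i) ≡ coeff (e *P h) i
    eq = trans (cong (_- a * coeff h (suc i)) (coeff-∷*P-suc a e h i))
               (cancel (a * coeff h (suc i)) (coeff (e *P h) i))
  coeff-*P-leading (a ∷ e) h (suc j) i       e↑ h↑ =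
    subst (m ∣_) (sym eq)
      (∣m∣n⇒∣m+n (∣n⇒∣m*n a (h↑ (suc (j ℕ.+ i)) (s≤s (ℕ.m≤n+m i j))))
                 (coeff-*P-leading e h j i (λ k j<k → e↑ (suc k) (s≤s j<k)) h↑))
    where
    assoc : ∀ x y z → x + y - z ≡ x + (y - z)
    assoc = ℤ-Solver.solve-∀
    x = a * coeff h (suc (j ℕ.+ i))
    eq : coeff ((a ∷ e) *P h) (suc (j ℕ.+ i)) - coeff e j * coeff h i ≡
         x + (coeff (e *P h) (j ℕ.+ i) - coeff e j * coeff h i)
    eq = trans (cong (_- coeff e j * coeff h i) (coeff-∷*P-suc a e h (j ℕ.+ i)))
               (assoc x (coeff (e *P h) (j ℕ.+ i)) (coeff e j * coeff h i))

  monic-*P-leading : ∀ {g n e j} → MonicMod m g n → DegreeMod m e j →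
                     ¬ (m ∣ coeff (g *P e) (n ℕ.+ j))
  monic-*P-leading {g} {n} {e} {j} (monicMod m∣gₙ-1 g↑) (degreeMod m∤eⱼ e↑) m∣c =
    m∤eⱼ (subst (m ∣_) (eliminate (coeff (g *P e) (n ℕ.+ j)) (coeff g n) (coeff e j))
      (∣m∣n⇒∣m-n (∣m∣n⇒∣m-n m∣c (coeff-*P-leading g e n j g↑ e↑)) (∣m⇒∣m*n (coeff e j) m∣gₙ-1)))
    where
    eliminate : ∀ c a b → c - (c - a * b) - (a - 1ℤ) * b ≡ b
    eliminate = ℤ-Solver.solve-∀

  monic⇒¬∣ᴾ : ∀ {D k} → ¬ (m ∣ 1ℤ) → MonicMod m D k → ¬ (m ∣ᴾ D)
  monic⇒¬∣ᴾ {D} {k} m∤1 (monicMod m∣Dₖ-1 _) m∣D =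
    m∤1 (subst (m ∣_) (one (coeff D k)) (∣m∣n⇒∣m-n (coeff-∣ m∣D k) m∣Dₖ-1))
    where
    one : ∀ x → x - (x - 1ℤ) ≡ 1ℤ
    one = ℤ-Solver.solve-∀

  ∤-lowerDegree : ∀ {g n D k} → ¬ (m ∣ 1ℤ) → MonicMod m g n → MonicMod m D k → k < n →
                  ¬ (g ∣ᴾ D [mod m ])
  ∤-lowerDegree {g} {n} {D} {k} m∤1 g-monic D-monic k<n (divides e D≡ge) with ∣ᴾ⊎degreeMod m e
  ... | inj₁ m∣e =
    monic⇒¬∣ᴾ m∤1 D-monic (≡ᴾ[]⇒∣ᴾ (≡ᴾ-trans D≡ge (∣ᴾ⇒≡ᴾ[] (∣ᴾ-*Pˡ g m∣e))))
  ... | inj₂ (j , e-deg) = monic-*P-leading {g} {n} {e} {j} g-monic e-deg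
    (∣m∣m-n⇒∣n (MonicMod.above D-monic (n ℕ.+ j) (ℕ.<-≤-trans k<n (ℕ.m≤m+n n j)))
               (subst (m ∣_) (coeff--P D (g *P e) (n ℕ.+ j)) (coeff-∣ (∣ᴾ-diff D≡ge) (n ℕ.+ j))))

module _ {p : ℕ} (p-prime : Prime p) where

  euclidsLemmaᴾ : ∀ a b → + p ∣ᴾ a *P b → + p ∣ᴾ a ⊎ + p ∣ᴾ b
  euclidsLemmaᴾ a b p∣ab with ∣ᴾ⊎degreeMod (+ p) a | ∣ᴾ⊎degreeMod (+ p) b
  ... | inj₁ p∣a | _        = inj₁ p∣a
  ... | inj₂ _   | inj₁ p∣b = inj₂ p∣b
  ... | inj₂ (j , degreeMod p∤aⱼ a↑) | inj₂ (i , degreeMod p∤bᵢ b↑)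
    with euclidsLemmaℤ p-prime (coeff a j) (coeff b i)
           (∣m∣m-n⇒∣n (coeff-∣ p∣ab (j ℕ.+ i)) (coeff-*P-leading a b j i a↑ b↑))
  ...   | inj₁ p∣aⱼ = ⊥-elim (p∤aⱼ p∣aⱼ)
  ...   | inj₂ p∣bᵢ = ⊥-elim (p∤bᵢ p∣bᵢ)

  ∣ᴾ-*P-cancelˡ : ∀ {a b} → ¬ (+ p ∣ᴾ a) → + p ∣ᴾ a *P b → + p ∣ᴾ b
  ∣ᴾ-*P-cancelˡ {a} {b} p∤a p∣ab with euclidsLemmaᴾ a b p∣ab
  ... | inj₁ p∣a = ⊥-elim (p∤a p∣a)
  ... | inj₂ p∣b = p∣b

-- Division with remainder; irreducible polynomials are prime modulo p

module _ {m : ℤ} {D : Poly} {k : ℕ} (D-monic : MonicMod m D k) where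
  open ≡ᴾ-Reasoning m

  divideMod : ∀ a → ∃₂ λ Q R → m ∣ᴾ R from k × a ≡ᴾ Q *P D +P R [mod m ]
  divideMod []      = [] , [] , (λ _ _ → ∣0) , ≡ᴾ-refl
  divideMod (a ∷ f) with divideMod f
  ... | Q , R , R↓ , f≡QD+R = (0ℤ ∷ Q) +P const c , s -P const c *P D , R′↓ , a∷f≡
    where
    s = a ∷ R
    c = coeff s k

    shift : (0ℤ ∷ Q) *P D +P s ≋ a ∷ (Q *P D +P R)
    shift = ≋-trans (+P-cong (*P-shiftˡ Q D) (≋-refl {s}))
                    (mk≋ λ { zero → ℤ.+-identityˡ a ; (suc i) → refl })

    reduce : ∀ D Q′ S C → Q′ *P D +P S ≋ (Q′ +P C) *P D +P (S -P C *P D)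
    reduce = solve-∀ ℤ[x]

    a∷f≡ : a ∷ f ≡ᴾ ((0ℤ ∷ Q) +P const c) *P D +P (s -P const c *P D) [mod m ]
    a∷f≡ = begin
      a ∷ f                                               ≈⟨ ∷-cong-≡ᴾ a f≡QD+R ⟩
      a ∷ (Q *P D +P R)                                   ≈⟨ ≋⇒≡ᴾ shift ⟨
      (0ℤ ∷ Q) *P D +P s                                  ≈⟨ ≋⇒≡ᴾ (reduce D (0ℤ ∷ Q) s (const c)) ⟩
      ((0ℤ ∷ Q) +P const c) *P D +P (s -P const c *P D)   ∎

    coeff-R′ : ∀ i → coeff (s -P const c *P D) i ≡ coeff s i - c * coeff D i
    coeff-R′ i = trans (coeff--P s (const c *P D) i) (cong (λ z → coeff s i - z) (coeff-const*P c D i))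

    R′↓ : m ∣ᴾ s -P const c *P D from k
    R′↓ i k≤i with ℕ.m≤n⇒m<n∨m≡n k≤i
    ... | inj₂ refl = subst (m ∣_) (sym (trans (coeff-R′ k) (factor c (coeff D k))))
                        (∣n⇒∣m*n (- c) (MonicMod.leading D-monic))
      where
      factor : ∀ c d → c - c * d ≡ - c * (d - 1ℤ)
      factor = ℤ-Solver.solve-∀
    ... | inj₁ k<i = subst (m ∣_) (sym (coeff-R′ i))
                        (∣m∣n⇒∣m-n (R↓′ i k<i) (∣n⇒∣m*n c (MonicMod.above D-monic i k<i)))
      where
      R↓′ : ∀ i → k < i → m ∣ coeff s i
      R↓′ (suc i) (s≤s k≤i) = R↓ i k≤i

degreeMod-< : ∀ {m R j k} → DegreeMod m R j → m ∣ᴾ R from k → j < k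
degreeMod-< {j = j} {k = k} (degreeMod m∤Rⱼ _) R↓ with k ℕ.≤? j
... | yes k≤j = ⊥-elim (m∤Rⱼ (R↓ j k≤j))
... | no  k≰j = ℕ.≰⇒> k≰j

module _ {m : ℤ} where
  open ≡ᴾ-Reasoning m

  ≡ᴾ-dropʳ : ∀ {a x R} → m ∣ᴾ R → a ≡ᴾ x +P R [mod m ] → a ≡ᴾ x [mod m ]
  ≡ᴾ-dropʳ {a} {x} {R} m∣R a≡x+R = begin
    a          ≈⟨ a≡x+R ⟩
    x +P R     ≈⟨ +P-cong-≡ᴾ (≋⇒≡ᴾ (≋-refl {x})) (∣ᴾ⇒≡ᴾ[] m∣R) ⟩
    x +P []    ≈⟨ ≋⇒≡ᴾ (+P-identityʳ x) ⟩
    x          ∎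

  inverse-*P-cancel : ∀ {a e} b → a *P e ≡ᴾ const 1ℤ [mod m ] → b ≡ᴾ e *P (a *P b) [mod m ]
  inverse-*P-cancel {a} {e} b ae≡1 = begin
    b                   ≈⟨ ≋⇒≡ᴾ (*P-identityˡ b) ⟨
    const 1ℤ *P b       ≈⟨ *P-congʳ-≡ᴾ b ae≡1 ⟨
    (a *P e) *P b       ≈⟨ ≋⇒≡ᴾ (rearrange a e b) ⟩
    e *P (a *P b)       ∎
    where
    rearrange : ∀ a e b → (a *P e) *P b ≋ e *P (a *P b)
    rearrange = solve-∀ ℤ[x]

  ∣ᴾ-mod-refl : ∀ {g} → g ∣ᴾ g [mod m ]
  ∣ᴾ-mod-refl {g} = divides (const 1ℤ) (≋⇒≡ᴾ (≋-sym (*P-identityʳ g)))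

  ∣ᴾ-mod-remainder : ∀ {g R b} X Q Y t → R ≡ᴾ X -P Q *P Y [mod m ] →
    g ∣ᴾ X *P b [mod m ] → g ∣ᴾ Y *P b [mod m ] → g ∣ᴾ (const t *P R) *P b [mod m ]
  ∣ᴾ-mod-remainder {g} {R} {b} X Q Y t R≡X-QY g∣Xb g∣Yb = ∣ᴾ-mod-resp (≡ᴾ-sym (begin
      (const t *P R) *P b                                 ≈⟨ *P-congʳ-≡ᴾ b (*P-congˡ-≡ᴾ (const t) R≡X-QY) ⟩
      (const t *P (X -P Q *P Y)) *P b                     ≈⟨ ≋⇒≡ᴾ (expand (const t) X Q Y b) ⟩
      const t *P (X *P b) -P (const t *P Q) *P (Y *P b)   ∎))
    (∣ᴾ-mod--P (∣ᴾ-mod-*Pˡ (const t) g∣Xb) (∣ᴾ-mod-*Pˡ (const t *P Q) g∣Yb))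
    where
    expand : ∀ T X Q Y b → (T *P (X -P Q *P Y)) *P b ≋ T *P (X *P b) -P (T *P Q) *P (Y *P b)
    expand = solve-∀ ℤ[x]

  ∣ᴾ-mod-^P : ∀ {g u} k .{{_ : ℕ.NonZero k}} → g ∣ᴾ u [mod m ] → g ∣ᴾ u ^P k [mod m ]
  ∣ᴾ-mod-^P {u = u} (suc k) = ∣ᴾ-mod-*Pʳ (u ^P k)

module _ {p : ℕ} (p-prime : Prime p) where

  monicMultiple : ∀ {R j} → DegreeMod (+ p) R j → ∃ λ t → MonicMod (+ p) (const t *P R) j
  monicMultiple {R} {j} (degreeMod p∤Rⱼ R↑) with inverseMod p-prime (coeff R j) p∤Rⱼ
  ... | t , p∣tRⱼ-1 = t , monicMod (subst (λ z → + p ∣ z - 1ℤ) (sym (coeff-const*P t R j)) p∣tRⱼ-1)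
                        λ i j<i → subst (+ p ∣_) (sym (coeff-const*P t R i)) (∣n⇒∣m*n t (R↑ i j<i))

module _ {p : ℕ} (p-prime : Prime p) {g : Poly} {n : ℕ}
         (g-monic : MonicMod (+ p) g n) (g-irr : IrreducibleMod p g) where

  -- By irreducibility Q or D is a unit; Q cannot be, as D has smaller degree than g.
  ∣ᴾ-mod-cancel-factor : ∀ {Q D k b} → k < n → MonicMod (+ p) D k → g ≡ᴾ Q *P D [mod + p ] →
                         g ∣ᴾ D *P b [mod + p ] → g ∣ᴾ b [mod + p ]
  ∣ᴾ-mod-cancel-factor {Q} {D} {k} {b} k<n D-monic g≡QD g∣Db with proj₂ (proj₂ g-irr) Q D (≡ᴾ⇒≡P g≡QD)
  ... | inj₁ (e , Qe≡1) = ⊥-elim (∤-lowerDegree (prime∤1 p-prime) g-monic D-monic k<n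
          (∣ᴾ-mod-resp (≡ᴾ-sym (inverse-*P-cancel {a = Q} {e = e} D (≡P⇒≡ᴾ Qe≡1)))
            (∣ᴾ-mod-*Pˡ e (∣ᴾ-mod-resp g≡QD ∣ᴾ-mod-refl))))
  ... | inj₂ (e , De≡1) =
          ∣ᴾ-mod-resp (≡ᴾ-sym (inverse-*P-cancel {a = D} {e = e} b (≡P⇒≡ᴾ De≡1))) (∣ᴾ-mod-*Pˡ e g∣Db)

  private
    LowerDegreeCancels : ℕ → Set
    LowerDegreeCancels k = ∀ {D b} → k < n → MonicMod (+ p) D k →
                           g ∣ᴾ D *P b [mod + p ] → g ∣ᴾ b [mod + p ]

  ∣ᴾ-mod-cancel-lowerDegree : ∀ k {D b} → k < n → MonicMod (+ p) D k →
                              g ∣ᴾ D *P b [mod + p ] → g ∣ᴾ b [mod + p ]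
  ∣ᴾ-mod-cancel-lowerDegree = <-rec LowerDegreeCancels descent
    where
    -- Euclid's algorithm: either D divides g, or a normalised remainder of g by D
    -- is a monic polynomial of smaller degree that inherits the hypothesis on D.
    descent : ∀ k → (∀ {j} → j < k → LowerDegreeCancels j) → LowerDegreeCancels k
    descent k rec {D} {b} k<n D-monic g∣Db with divideMod D-monic g
    ... | Q , R , R↓ , g≡QD+R with ∣ᴾ⊎degreeMod (+ p) R
    ...   | inj₁ p∣R = ∣ᴾ-mod-cancel-factor {Q} k<n D-monic (≡ᴾ-dropʳ p∣R g≡QD+R) g∣Db
    ...   | inj₂ (j , R-deg) with monicMultiple p-prime R-deg
    ...     | t , tR-monic = rec j<k (ℕ.<-trans j<k k<n) tR-monic
                (∣ᴾ-mod-remainder g Q D t (+P-≡ᴾ-transpose g≡QD+R) (∣ᴾ-mod-self b) g∣Db)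
      where j<k = degreeMod-< R-deg R↓

  ∣ᴾ-mod-*P⇒⊎ : ∀ a b → g ∣ᴾ a *P b [mod + p ] → g ∣ᴾ a [mod + p ] ⊎ g ∣ᴾ b [mod + p ]
  ∣ᴾ-mod-*P⇒⊎ a b g∣ab with divideMod g-monic a
  ... | Q , R , R↓ , a≡Qg+R with ∣ᴾ⊎degreeMod (+ p) R
  ...   | inj₁ p∣R = inj₁ (divides Q (≡ᴾ-trans (≡ᴾ-dropʳ p∣R a≡Qg+R) (≋⇒≡ᴾ (*P-comm Q g))))
  ...   | inj₂ (j , R-deg) with monicMultiple p-prime R-deg
  ...     | t , tR-monic = inj₂ (∣ᴾ-mod-cancel-lowerDegree j (degreeMod-< R-deg R↓) tR-monic
              (∣ᴾ-mod-remainder a Q g t (+P-≡ᴾ-transpose a≡Qg+R) g∣ab (∣ᴾ-mod-self b)))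

  ∣ᴾ-mod-^P⇒ : ∀ k {u} → g ∣ᴾ u ^P k [mod + p ] → g ∣ᴾ u [mod + p ]
  ∣ᴾ-mod-^P⇒ zero    (divides w 1≡gw) = ⊥-elim (proj₁ (proj₂ g-irr) (w , ≡ᴾ⇒≡P (≡ᴾ-sym 1≡gw)))
  ∣ᴾ-mod-^P⇒ (suc k) {u} g∣uᵏ⁺¹ with ∣ᴾ-mod-*P⇒⊎ u (u ^P k) g∣uᵏ⁺¹
  ... | inj₁ g∣u  = g∣u
  ... | inj₂ g∣uᵏ = ∣ᴾ-mod-^P⇒ k g∣uᵏ

  ∣ᴾ-mod-^P⇔ : ∀ u → g ∣ᴾ u ^P p [mod + p ] ⇔ g ∣ᴾ u [mod + p ]
  ∣ᴾ-mod-^P⇔ u = mk⇔ (∣ᴾ-mod-^P⇒ p) (∣ᴾ-mod-^P p {{prime⇒nonZero p-prime}})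

-- Substitution and the Frobenius congruence

const-cong : ∀ {a b} → a ≡ b → const a ≋ const b
const-cong refl = ≋-refl

const0≋[] : const 0ℤ ≋ []
const0≋[] = mk≋ λ { zero → refl ; (suc n) → refl }

compose-const : ∀ c h → compose (const c) h ≋ const c
compose-const c h = ≋-trans (+P-cong (≋-refl {const c}) (*P-zeroʳ h)) (+P-identityʳ (const c))

module _ (h : Poly) where

  compose-≋[] : ∀ {f} → [] ≋ f → compose f h ≋ []
  compose-≋[] {[]}    _ = ≋-refl
  compose-≋[] {b ∷ f} e = begin
    const b +P h *P compose f h   ≈⟨ +P-cong (≋-trans (const-cong (sym (coeff-≡ e 0))) const0≋[])
                                              (*P-congˡ h (compose-≋[] {f} (mk≋ λ n → coeff-≡ e (suc n)))) ⟩
    h *P []                       ≈⟨ *P-zeroʳ h ⟩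
    []                            ∎
    where open ≋-Reasoning

  compose-cong : ∀ {f f′} → f ≋ f′ → compose f h ≋ compose f′ h
  compose-cong {[]}    {[]}      e = ≋-refl
  compose-cong {[]}    {b ∷ f′}  e = ≋-sym (compose-≋[] e)
  compose-cong {a ∷ f} {[]}      e = compose-≋[] (≋-sym e)
  compose-cong {a ∷ f} {b ∷ f′}  e =
    +P-cong (const-cong (coeff-≡ e 0)) (*P-congˡ h (compose-cong {f} {f′} (mk≋ λ n → coeff-≡ e (suc n))))

  compose-+P : ∀ f g → compose (f +P g) h ≋ compose f h +P compose g h
  compose-+P []      g       = ≋-refl
  compose-+P (a ∷ f) []      = ≋-sym (+P-identityʳ _)
  compose-+P (a ∷ f) (b ∷ g) =
    ≋-trans (+P-cong (≋-refl {const a +P const b}) (*P-congˡ h (compose-+P f g)))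
            (regroup (const a) (const b) h (compose f h) (compose g h))
    where
    regroup : ∀ A B H F G → (A +P B) +P H *P (F +P G) ≋ (A +P H *P F) +P (B +P H *P G)
    regroup = solve-∀ ℤ[x]

  compose-·P : ∀ c f → compose (c ·P f) h ≋ const c *P compose f h
  compose-·P c []      = ≋-sym (*P-zeroʳ (const c))
  compose-·P c (b ∷ f) =
    ≋-trans (+P-cong const-* (*P-congˡ h (compose-·P c f)))
            (factor (const c) (const b) h (compose f h))
    where
    const-* : const (c * b) ≋ const c *P const b
    const-* = mk≋ λ { zero → sym (ℤ.+-identityʳ (c * b)) ; (suc n) → refl }
    factor : ∀ C B H F → C *P B +P H *P (C *P F) ≋ C *P (B +P H *P F)
    factor = solve-∀ ℤ[x]

  compose-*P : ∀ f g → compose (f *P g) h ≋ compose f h *P compose g h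
  compose-*P []      g = ≋-refl
  compose-*P (a ∷ f) g = begin
    compose (a ·P g +P (0ℤ ∷ f *P g)) h
      ≈⟨ compose-+P (a ·P g) (0ℤ ∷ f *P g) ⟩
    compose (a ·P g) h +P (const 0ℤ +P h *P compose (f *P g) h)
      ≈⟨ +P-cong (compose-·P a g) (+P-cong const0≋[] (*P-congˡ h (compose-*P f g))) ⟩
    const a *P compose g h +P ([] +P h *P (compose f h *P compose g h))
      ≈⟨ distrib (const a) h (compose f h) (compose g h) ⟩
    (const a +P h *P compose f h) *P compose g h
      ∎
    where
    open ≋-Reasoning
    distrib : ∀ A H F G → A *P G +P ([] +P H *P (F *P G)) ≋ (A +P H *P F) *P G
    distrib = solve-∀ ℤ[x]

module _ {p : ℕ} (p-prime : Prime p) where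
  open CommutativeRing ℤ/ + p [x] using (commutativeSemiring; semiring)
  import Algebra.Properties.Semiring.Mult semiring as Mult
  open import Algebra.Properties.Semiring.Exp semiring using (_^_; ^-congˡ)
  open import Algebra.Properties.CommutativeSemiring.Exp commutativeSemiring using (^-distrib-*)
  open ≡ᴾ-Reasoning (+ p)

  private instance
    p≢0 : ℕ.NonZero p
    p≢0 = prime⇒nonZero p-prime

  ^P≡^ : ∀ h n → h ^P n ≡ h ^ n
  ^P≡^ h zero    = refl
  ^P≡^ h (suc n) = cong (h *P_) (^P≡^ h n)

  coeff-× : ∀ n f i → coeff (n Mult.× f) i ≡ + n * coeff f i
  coeff-× zero    f i = sym (ℤ.*-zeroˡ (coeff f i))
  coeff-× (suc n) f i =
    trans (coeff-+P f (n Mult.× f) i) (trans (cong (λ z → coeff f i + z) (coeff-× n f i)) (collect (coeff f i) (+ n)))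
    where
    collect : ∀ x n → x + n * x ≡ (1ℤ + n) * x
    collect = ℤ-Solver.solve-∀

  char-p : p Mult.× const 1ℤ ≡ᴾ [] [mod + p ]
  char-p = ∣ᴾ⇒≡ᴾ[] (mk∣ᴾ λ i →
    subst (+ p ∣_) (sym (coeff-× p (const 1ℤ) i)) (∣m⇒∣m*n (coeff (const 1ℤ) i) ∣-refl))

  const≋×1 : ∀ n → const (+ n) ≋ n Mult.× const 1ℤ
  const≋×1 zero    = const0≋[]
  const≋×1 (suc n) = +P-cong (≋-refl {const 1ℤ}) (const≋×1 n)

  const≡const%ℕ : ∀ c → const c ≡ᴾ const (+ (c %ℕ p)) [mod + p ]
  const≡const%ℕ c = mk≡ᴾ (∣ᴾ-∷ (divides (c /ℕ p) c-r≡qp) ∣ᴾ-[])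
    where
    c-r≡qp : c - + (c %ℕ p) ≡ c /ℕ p * + p
    c-r≡qp = trans (cong (_- + (c %ℕ p)) (a≡a%ℕn+[a/ℕn]*n c p)) (cancel (+ (c %ℕ p)) (c /ℕ p * + p))
      where
      cancel : ∀ r x → r + x - r ≡ x
      cancel = ℤ-Solver.solve-∀

  fermatᴾ : ∀ c → const c ^P p ≡ᴾ const c [mod + p ]
  fermatᴾ c = begin
    const c ^P p     ≡⟨ ^P≡^ (const c) p ⟩
    const c ^ p      ≈⟨ ^-congˡ p (≡ᴾ-trans (const≡const%ℕ c) (≋⇒≡ᴾ (const≋×1 r))) ⟩
    (r Mult.× const 1ℤ) ^ p   ≈⟨ fermat commutativeSemiring p-prime char-p r ⟩
    r Mult.× const 1ℤ ≈⟨ ≡ᴾ-trans (const≡const%ℕ c) (≋⇒≡ᴾ (const≋×1 r)) ⟨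
    const c          ∎
    where r = c %ℕ p

  X*P≋shift : ∀ f → X *P f ≋ 0ℤ ∷ f
  X*P≋shift f = ≋-trans (*P-shiftˡ (const 1ℤ) f) (∷-cong 0ℤ (*P-identityˡ f))

  frobenius : ∀ f → compose f (X ^P p) ≡ᴾ f ^P p [mod + p ]
  frobenius []      = begin
    []               ≈⟨ fermat commutativeSemiring p-prime char-p 0 ⟨
    [] ^ p           ≡⟨ ^P≡^ [] p ⟨
    [] ^P p          ∎
  frobenius (a ∷ f) = begin
    const a +P X ^P p *P compose f (X ^P p)
      ≈⟨ +P-cong-≡ᴾ (≡ᴾ-sym (fermatᴾ a)) (*P-congˡ-≡ᴾ (X ^P p) (frobenius f)) ⟩
    const a ^P p +P X ^P p *P f ^P p
      ≡⟨ cong₂ _+P_ (^P≡^ (const a) p) (cong₂ _*P_ (^P≡^ X p) (^P≡^ f p)) ⟩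
    const a ^ p +P X ^ p *P f ^ p
      ≈⟨ +P-cong-≡ᴾ (≡ᴾ-refl {x = const a ^ p}) (^-distrib-* X f p) ⟨
    const a ^ p +P (X *P f) ^ p
      ≈⟨ freshman's-dream commutativeSemiring p-prime char-p (const a) (X *P f) ⟨
    (const a +P X *P f) ^ p
      ≈⟨ ^-congˡ p (≋⇒≡ᴾ (≋-sym a∷f≋a+Xf)) ⟩
    (a ∷ f) ^ p
      ≡⟨ ^P≡^ (a ∷ f) p ⟨
    (a ∷ f) ^P p
      ∎
    where
    a∷f≋a+Xf : a ∷ f ≋ const a +P X *P f
    a∷f≋a+Xf = ≋-trans (∷-split a f) (+P-cong (≋-refl {const a}) (≋-sym (X*P≋shift f)))

-- The ideals ⟨a, b⟩ and ⟨a, b⟩²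

Combination² : Poly → Poly → Poly → Set
Combination² a b h = ∃ λ A → ∃₂ λ B C → h ≋ a *P a *P A +P a *P b *P B +P b *P b *P C

module _ (a b : Poly) where

  sum-∈⟨pair⟩ : ∀ cs → All (λ c → pair a b (proj₂ c)) cs →
                ∃₂ λ α β → sumP (map (λ c → proj₁ c *P proj₂ c) cs) ≋ a *P α +P b *P β
  sum-∈⟨pair⟩ []             []           = [] , [] , ≋-sym (zeros a b)
    where
    zeros : ∀ a b → a *P [] +P b *P [] ≋ []
    zeros = solve-∀ ℤ[x]
  sum-∈⟨pair⟩ ((c , s) ∷ cs) (s∈ ∷ all) with sum-∈⟨pair⟩ cs all | s∈
  ... | α , β , rest≋ | inj₁ s≈a =
    c +P α , β , ≋-trans (+P-cong (*P-congˡ c (mk≋ s≈a)) rest≋) (regroup c a b α β)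
    where
    regroup : ∀ c a b α β → c *P a +P (a *P α +P b *P β) ≋ a *P (c +P α) +P b *P β
    regroup = solve-∀ ℤ[x]
  ... | α , β , rest≋ | inj₂ s≈b =
    α , c +P β , ≋-trans (+P-cong (*P-congˡ c (mk≋ s≈b)) rest≋) (regroup c a b α β)
    where
    regroup : ∀ c a b α β → c *P b +P (a *P α +P b *P β) ≋ a *P α +P b *P (c +P β)
    regroup = solve-∀ ℤ[x]

  ∈⟨pair⟩⇒combination : ∀ {h} → ⟨ pair a b ⟩ h → ∃₂ λ α β → h ≋ a *P α +P b *P β
  ∈⟨pair⟩⇒combination (cs , all , h≈) with sum-∈⟨pair⟩ cs all
  ... | α , β , sum≋ = α , β , ≋-trans (mk≋ h≈) sum≋

  generator∈⟨pair⟩ : ∀ {x} → pair a b x → ⟨ pair a b ⟩ x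
  generator∈⟨pair⟩ {x} x∈ =
    (const 1ℤ , x) ∷ [] , x∈ ∷ [] , coeff-≡ (≋-sym (≋-trans (+P-identityʳ _) (*P-identityˡ x)))

  sum-∈⟨pair⟩² : ∀ cs →
    All (λ c → Σ Poly λ x → Σ Poly λ y → ⟨ pair a b ⟩ x × ⟨ pair a b ⟩ y × (proj₂ c ≈P x *P y)) cs →
    Combination² a b (sumP (map (λ c → proj₁ c *P proj₂ c) cs))
  sum-∈⟨pair⟩² []             []           = [] , [] , [] , ≋-sym (zeros a b)
    where
    zeros : ∀ a b → a *P a *P [] +P a *P b *P [] +P b *P b *P [] ≋ []
    zeros = solve-∀ ℤ[x]
  sum-∈⟨pair⟩² ((c , s) ∷ cs) ((x , y , x∈ , y∈ , s≈xy) ∷ all)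
    with sum-∈⟨pair⟩² cs all | ∈⟨pair⟩⇒combination {x} x∈ | ∈⟨pair⟩⇒combination {y} y∈
  ... | A , B , C , rest≋ | α , β , x≋ | α′ , β′ , y≋ =
    _ , _ , _ , ≋-trans (+P-cong (*P-congˡ c (≋-trans (mk≋ s≈xy) (*P-cong x≋ y≋))) rest≋)
                        (regroup c a b α β α′ β′ A B C)
    where
    regroup : ∀ c a b α β α′ β′ A B C →
      c *P ((a *P α +P b *P β) *P (a *P α′ +P b *P β′)) +P
        (a *P a *P A +P a *P b *P B +P b *P b *P C) ≋
      a *P a *P (c *P α *P α′ +P A) +P a *P b *P (c *P (α *P β′ +P β *P α′) +P B) +P
        b *P b *P (c *P β *P β′ +P C)
    regroup = solve-∀ ℤ[x]

  ∈⟨pair⟩²⇔combination² : ∀ {h} → (⟨ pair a b ⟩ ·I ⟨ pair a b ⟩) h ⇔ Combination² a b h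
  ∈⟨pair⟩²⇔combination² {h} = mk⇔ to from
    where
    to : (⟨ pair a b ⟩ ·I ⟨ pair a b ⟩) h → Combination² a b h
    to (cs , all , h≈) with sum-∈⟨pair⟩² cs all
    ... | A , B , C , sum≋ = A , B , C , ≋-trans (mk≋ h≈) sum≋

    a∈ = generator∈⟨pair⟩ {a} (inj₁ (λ _ → refl))
    b∈ = generator∈⟨pair⟩ {b} (inj₂ (λ _ → refl))

    from : Combination² a b h → (⟨ pair a b ⟩ ·I ⟨ pair a b ⟩) h
    from (A , B , C , h≋) =
      (A , a *P a) ∷ (B , a *P b) ∷ (C , b *P b) ∷ [] ,
      (a , a , a∈ , a∈ , (λ _ → refl)) ∷ (a , b , a∈ , b∈ , (λ _ → refl)) ∷
        (b , b , b∈ , b∈ , (λ _ → refl)) ∷ [] ,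
      coeff-≡ (≋-trans h≋ (as-sum a b A B C))
      where
      as-sum : ∀ a b A B C → a *P a *P A +P a *P b *P B +P b *P b *P C ≋
                             A *P (a *P a) +P (B *P (a *P b) +P (C *P (b *P b) +P []))
      as-sum = solve-∀ ℤ[x]

module _ {p : ℕ} (p-prime : Prime p) {g : Poly} (p∤g : ¬ (+ p ∣ᴾ g)) where
  private
    P = const (+ p)
    instance
      p≢0 : ℕ.NonZero p
      p≢0 = prime⇒nonZero p-prime

  ∈⟨p,g⟩²⇔∣ : ∀ {h u v} → h ≋ P *P u +P g *P g *P v →
              (⟨ pair P g ⟩ ·I ⟨ pair P g ⟩) h ⇔ g ∣ᴾ u [mod + p ]
  ∈⟨p,g⟩²⇔∣ {h} {u} {v} h≋ = ⇔.trans (∈⟨pair⟩²⇔combination² P g {h}) (mk⇔ to from)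
    where
    -- Comparing the two forms of h gives g²(C − v) = p(u − pA − gB); since p ∤ g,
    -- p divides C − v, and cancelling p shows that u ≡ g(g e + B) modulo p.
    to : Combination² P g h → g ∣ᴾ u [mod + p ]
    to (A , B , C , h≋′) = divides (g *P e +P B) (≋+const*P⇒≡ᴾ A u≋)
      where
      open ≋-Reasoning
      Y = P *P A +P g *P B
      W = P *P u +P g *P g *P v

      gg[C-v]≋PY : g *P (g *P (C -P v)) ≋ P *P (u -P Y)
      gg[C-v]≋PY = begin
        g *P (g *P (C -P v))
          ≈⟨ split P u g v A B C ⟩
        P *P (u -P Y) +P ((P *P P *P A +P P *P g *P B +P g *P g *P C) -P W)
          ≈⟨ +P-cong (≋-refl {P *P (u -P Y)}) (≋-trans (+P-cong (≋-trans (≋-sym h≋′) h≋) (≋-refl {negP W}))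
                                                       (negP-inverseʳ W)) ⟩
        P *P (u -P Y) +P []
          ≈⟨ +P-identityʳ (P *P (u -P Y)) ⟩
        P *P (u -P Y)
          ∎
        where
        split : ∀ P u g v A B C → g *P (g *P (C -P v)) ≋
          P *P (u -P (P *P A +P g *P B)) +P
            ((P *P P *P A +P P *P g *P B +P g *P g *P C) -P (P *P u +P g *P g *P v))
        split = solve-∀ ℤ[x]

      p∣C-v : + p ∣ᴾ C -P v
      p∣C-v = ∣ᴾ-*P-cancelˡ p-prime p∤g (∣ᴾ-*P-cancelˡ p-prime p∤g
                (∣ᴾ-resp-≋ (≋-sym gg[C-v]≋PY) (∣ᴾ-const*P (u -P Y))))

      e = proj₁ (∣ᴾ⇒const*P p∣C-v)

      gge≋u-Y : g *P (g *P e) ≋ u -P Y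
      gge≋u-Y = const*P-cancelˡ (+ p) (begin
        P *P (g *P (g *P e))     ≈⟨ swap P g e ⟩
        g *P (g *P (P *P e))     ≈⟨ *P-congˡ g (*P-congˡ g (≋-sym (proj₂ (∣ᴾ⇒const*P p∣C-v)))) ⟩
        g *P (g *P (C -P v))     ≈⟨ gg[C-v]≋PY ⟩
        P *P (u -P Y)            ∎)
        where
        swap : ∀ P g e → P *P (g *P (g *P e)) ≋ g *P (g *P (P *P e))
        swap = solve-∀ ℤ[x]

      u≋ : u ≋ g *P (g *P e +P B) +P P *P A
      u≋ = begin
        u                          ≈⟨ split u Y ⟩
        (u -P Y) +P Y              ≈⟨ +P-cong (≋-sym gge≋u-Y) (≋-refl {Y}) ⟩
        g *P (g *P e) +P Y         ≈⟨ regroup g e P A B ⟩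
        g *P (g *P e +P B) +P P *P A ∎
        where
        split : ∀ u Y → u ≋ (u -P Y) +P Y
        split = solve-∀ ℤ[x]
        regroup : ∀ g e P A B → g *P (g *P e) +P (P *P A +P g *P B) ≋ g *P (g *P e +P B) +P P *P A
        regroup = solve-∀ ℤ[x]

    from : g ∣ᴾ u [mod + p ] → Combination² P g h
    from (divides w u≡gw) with ≡ᴾ⇒≋+const*P u≡gw
    ... | e , u≋gw+Pe = e , w , v ,
      ≋-trans h≋ (≋-trans (+P-cong (*P-congˡ P u≋gw+Pe) (≋-refl {g *P g *P v})) (expand P g w e v))
      where
      expand : ∀ P g w e v → P *P (g *P w +P P *P e) +P g *P g *P v ≋ P *P P *P e +P P *P g *P w +P g *P g *P v
      expand = solve-∀ ℤ[x]

-- With g(x^p) = g·g^(p-1) + p·w, expanding f(x^p) = p·u(x^p) + g(x^p)²·v(x^p) gives u′.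
compose-X^p-shape : ∀ {p} → Prime p → ∀ g u v → ∃₂ λ u′ v′ →
  compose (const (+ p) *P u +P g *P g *P v) (X ^P p) ≋ const (+ p) *P u′ +P g *P g *P v′ ×
  ∃ λ y → u′ ≡ᴾ compose u (X ^P p) +P g *P y [mod + p ]
compose-X^p-shape {zero}  p-prime = ⊥-elim (¬prime[0] p-prime)
compose-X^p-shape {suc q} p-prime g u v with ≡ᴾ⇒≋+const*P (frobenius p-prime g)
... | w , φg≋ = u′ , G *P G *P V , φf≋ , y , ≋+const*P⇒≡ᴾ (w *P w *P V) ≋-refl
  where
  P = const (+ suc q)
  Xᵖ = X ^P suc q
  φ : Poly → Poly
  φ f = compose f Xᵖ
  G = g ^P q
  V = φ v
  y = G *P w *P V +P G *P w *P V
  u′ = φ u +P g *P y +P P *P (w *P w *P V)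

  φf≋ : φ (P *P u +P g *P g *P v) ≋ P *P u′ +P g *P g *P (G *P G *P V)
  φf≋ = begin
    φ (P *P u +P g *P g *P v)
      ≈⟨ ≋-trans (compose-+P Xᵖ (P *P u) (g *P g *P v))
           (+P-cong (compose-*P Xᵖ P u) (≋-trans (compose-*P Xᵖ (g *P g) v) (*P-congʳ V (compose-*P Xᵖ g g)))) ⟩
    φ P *P φ u +P φ g *P φ g *P V
      ≈⟨ +P-cong (*P-congʳ (φ u) (compose-const (+ suc q) Xᵖ)) (*P-congʳ V (*P-cong φg≋ φg≋)) ⟩
    P *P φ u +P (g *P G +P P *P w) *P (g *P G +P P *P w) *P V
      ≈⟨ expand P (φ u) g G w V ⟩
    P *P u′ +P g *P g *P (G *P G *P V)
      ∎
    where
    open ≋-Reasoning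
    expand : ∀ P U g G w V → P *P U +P (g *P G +P P *P w) *P (g *P G +P P *P w) *P V ≋
      P *P (U +P g *P (G *P w *P V +P G *P w *P V) +P P *P (w *P w *P V)) +P g *P g *P (G *P G *P V)
    expand = solve-∀ ℤ[x]

theorem2p4 : (f g : Poly) (p : ℕ) → Prime p → Monic f → Monic g →
    IrreducibleMod p g →
    ⟨ pair (const (+ p)) (g *P g) ⟩ f →
    ((⟨ pair (const (+ p)) g ⟩ ·I ⟨ pair (const (+ p)) g ⟩) f
      ⇔ (⟨ pair (const (+ p)) g ⟩ ·I ⟨ pair (const (+ p)) g ⟩) (compose f (X ^P p)))
theorem2p4 f g p p-prime _ g-monic g-irr f∈⟨p,g²⟩
  with monic⇒monicMod {+ p} g-monic | ∈⟨pair⟩⇒combination (const (+ p)) (g *P g) {f} f∈⟨p,g²⟩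
... | n , g-monicMod | u , v , f≋ with compose-X^p-shape p-prime g u v
... | u′ , v′ , φf≋ , y , u′≡ = begin
  (⟨ pair P g ⟩ ·I ⟨ pair P g ⟩) f                 ∼⟨ ∈⟨p,g⟩²⇔∣ p-prime p∤g f≋ ⟩
  g ∣ᴾ u [mod + p ]                                ∼⟨ ⇔.sym (∣ᴾ-mod-^P⇔ p-prime g-monicMod g-irr u) ⟩
  g ∣ᴾ u ^P p [mod + p ]                           ∼⟨ ∣ᴾ-mod-resp⇔ (≡ᴾ-sym (frobenius p-prime u)) ⟩
  g ∣ᴾ compose u (X ^P p) [mod + p ]               ∼⟨ ∣ᴾ-mod-+P-multiple⇔ (compose u (X ^P p)) y ⟩
  g ∣ᴾ compose u (X ^P p) +P g *P y [mod + p ]     ∼⟨ ∣ᴾ-mod-resp⇔ (≡ᴾ-sym u′≡) ⟩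
  g ∣ᴾ u′ [mod + p ]                               ∼⟨ ⇔.sym (∈⟨p,g⟩²⇔∣ p-prime p∤g φf≋′) ⟩
  (⟨ pair P g ⟩ ·I ⟨ pair P g ⟩) (compose f (X ^P p)) ∎
  where
  open EquationalReasoning {k = Kind.equivalence}
  P = const (+ p)
  p∤g = monic⇒¬∣ᴾ (prime∤1 p-prime) g-monicMod
  φf≋′ = ≋-trans (compose-cong (X ^P p) f≋) φf≋
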